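{- Let $H=(V,E,w)$ be a hypergraph of rank $r$ with nonnegative hyperedge weights, let $f\ge 1$, $\mu\ge 1$ and $\alpha\ge 0$. Let $S_1$ be an $f$-edge-fault-tolerant multiplicative $\mu$-hyperspanner of $H$ and let $S_2$ be a (fault-free) additive hyperspanner of $H$ with surplus $\alpha$. Then $S=S_1\cup S_2$ (the sub-hypergraph whose hyperedge set is the union of those of $S_1$ and $S_2$), which has size $|S_1\cup S_2|$, satisfies: for all $s,t\in V$ and every $F\subseteq E$ with $|F|\le f$, $$\delta_{S\setminus F}(s,t)\le \delta_{H\setminus F}(s,t)+fr\big(2\alpha+(\mu-1)W_{s,t}\big)+\alpha,$$ where $W_{s,t}$ is the maximum hyperedge weight on a shortest $s$–$t$ path in $H\setminus F$.
   Context: The rank of a hypergraph is the maximum hyperedge size. A path between $u$ and $v$ is a sequence of vertices $u=x_0,\dots,x_\ell=v$ with hyperedges $h_1,\dots,h_\ell$ such that $x_{j-1},x_j\in h_j$; its length is $\sum_j w(h_j)$, and $\delta_H(u,v)$ is the minimum length of a $u$–$v$ path in $H$. For $F\subseteq E$, $H\setminus F$ has hyperedge set $E\setminus F$. A sub-hypergraph $S=(V,E')$, $E'\subseteq E$, is an $f$-EFT multiplicative $\mu$-hyperspanner of $H$ if $\delta_{S\setminus F}(u,v)\le \mu\,\delta_{H\setminus F}(u,v)$ for all $u,v\in V$ and all $F\subseteq E$ with $|F|\le f$; it is an additive hyperspanner with surplus $\alpha$ if $\delta_{S}(u,v)\le \delta_{H}(u,v)+\alpha$ for all $u,v\in V$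.
   Formalization: The hyperedge weights and the parameters μ and α take rational values. -}

module Defs where

open import Data.Nat using (ℕ; _≡ᵇ_)
open import Data.Fin using (Fin)
open import Data.Fin.Subset using (Subset; _∈_; ∣_∣; ∁; _∩_; _∪_; ⊤)
open import Data.Rational using (ℚ; 0ℚ; _+_; _*_; _≤_; _⊔_)
open import Data.Product using (Σ; ∃; _×_)
open import Relation.Binary.PropositionalEquality using (_≡_)

-- A weighted hypergraph H = (V, E, w) with V = Fin n and E = Fin m:
--   e : Fin m → Subset n   gives the vertex set of each hyperedge,
--   w : Fin m → ℚ          gives its weight.
-- A sub-hypergraph (V, E') is given by E' : Subset m.

IsRank : ∀ {n m} → (Fin m → Subset n) → ℕ → Set
IsRank {m = m} e r = (∀ (h : Fin m) → ∣ e h ∣ Data.Nat.≤ r) × (Σ (Fin m) λ h → ∣ e h ∣ ≡ r)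

data Path {n m : ℕ} (e : Fin m → Subset n) (A : Subset m) : Fin n → Fin n → Set where
  []   : ∀ {u} → Path e A u u
  step : ∀ {u x v} (h : Fin m) → h ∈ A → u ∈ e h → x ∈ e h → Path e A x v → Path e A u v

len : ∀ {n m} {e : Fin m → Subset n} {A : Subset m} {u v} →
      (Fin m → ℚ) → Path e A u v → ℚ
len w []                 = 0ℚ
len w (step h _ _ _ p)   = w h + len w p

maxW : ∀ {n m} {e : Fin m → Subset n} {A : Subset m} {u v} →
       (Fin m → ℚ) → Path e A u v → ℚ
maxW w []                = 0ℚ
maxW w (step h _ _ _ p)  = w h ⊔ maxW w p

IsShortest : ∀ {n m} (e : Fin m → Subset n) (w : Fin m → ℚ) {A : Subset m} {u v} →
             Path e A u v → Set
IsShortest e w {A} {u} {v} P = ∀ (Q : Path e A u v) → len w P ≤ len w Q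

-- δ_A(u,v) ≤ X, where δ_A is the minimum length of a u–v path using hyperedges in A:
-- some u–v path in A has length at most X.
DistAtMost : ∀ {n m} (e : Fin m → Subset n) (w : Fin m → ℚ) (A : Subset m) →
             Fin n → Fin n → ℚ → Set
DistAtMost e w A u v X = Σ (Path e A u v) λ Q → len w Q ≤ X

-- S is an f-EFT multiplicative μ-hyperspanner of H:
-- for all u, v and F ⊆ E with |F| ≤ f, δ_{S∖F}(u,v) ≤ μ · δ_{H∖F}(u,v),
-- i.e. for every u–v path P in H ∖ F, δ_{S∖F}(u,v) ≤ μ · len P.
IsFTMultSpanner : ∀ {n m} (e : Fin m → Subset n) (w : Fin m → ℚ) →
                  Subset m → ℕ → ℚ → Set
IsFTMultSpanner {n} {m} e w S f μ =
  ∀ (F : Subset m) → ∣ F ∣ Data.Nat.≤ f → ∀ (u v : Fin n) (P : Path e (∁ F) u v) →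
  DistAtMost e w (S ∩ ∁ F) u v (μ * len w P)

-- S is an additive hyperspanner of H with surplus α:
-- δ_S(u,v) ≤ δ_H(u,v) + α, i.e. for every u–v path P in H, δ_S(u,v) ≤ len P + α.
IsAdditiveSpanner : ∀ {n m} (e : Fin m → Subset n) (w : Fin m → ℚ) →
                    Subset m → ℚ → Set
IsAdditiveSpanner {n} {m} e w S α =
  ∀ (u v : Fin n) (P : Path e ⊤ u v) → DistAtMost e w S u v (len w P + α)

{-# OPTIONS --safe #-}
-- Walk along P, keeping a path in (S₁ ∪ S₂) ∖ F from s to the current vertex u of P. A round jumps
-- from u along a fault-free S₂-path to the last vertex v of P that can be reached that way with an
-- additive loss of at most 2α (u itself qualifies), and then crosses the next hyperedge h of P by its
-- replacement in S₁ ∖ F, of length at most μ w(h) ≤ w(h) + (μ - 1) W with W the largest weight on P.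
-- So a round costs 2α + (μ - 1) W.
-- To count rounds, let Q be an S₂-path from u to the far end of h that is within α of a shortest path
-- of H. Q must use a hyperedge of F, since otherwise it would be a jump beyond v; let a be the first
-- vertex of Q on a faulty hyperedge. The part of Q before a is again within α of shortest, and gluing
-- it to such a path from a later round's start to a would again give a jump beyond v. So every round
-- uses up its own vertex incident to F, and there are at most f r of them. The last round reaches t
-- either through S₂ ∖ F with loss α, or by a 2α-jump paid for by a further vertex incident to F.

module Submission where

open import Defs
open import Data.Nat using (ℕ; _*_)
open import Data.Fin using (Fin)
open import Data.Fin.Subset using (Subset; ∣_∣; ∁; _∩_; _∪_)
open import Data.Integer using (+_)
open import Data.Rational using (ℚ; 0ℚ; 1ℚ; _+_; _-_; _≤_; _/_)

open import Data.Nat as ℕ using (zero; suc; z≤n; s≤s)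
import Data.Nat.Properties as ℕₚ
open import Data.Fin using (zero; suc)
open import Data.Fin.Properties using (_≟_)
open import Data.Fin.Subset using (_∈_; _∉_; _⊆_; ⊤; ⊥; ⁅_⁆; inside; outside) renaming (_-_ to _∖_)
open import Data.Fin.Subset.Properties
  using (_∈?_; ⊆⊤; x∈⁅x⁆; x∈⁅y⁆⇒x≡y; ∣⁅x⁆∣≡1; ∣⊥∣≡0; ∣p∣≤n; p⊂q⇒∣p∣<∣q∣; q⊆p∪q; x∈p∪q⁺; x∈p∪q⁻;
         x∈p∩q⁺; x∈p∩q⁻; x∉p⇒x∈∁p; p⊆p∪q; x∈p∧x≢y⇒x∈p-y; x∈p⇒∣p-x∣<∣p∣)
open import Data.Vec using (_∷_; []; here; there)
open import Data.List as List using (List; concatMap; allFin)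
open import Data.List.Membership.Propositional using (lose)
open import Data.List.Membership.Propositional.Properties using (∈-allFin)
open import Data.List.Relation.Unary.Any as Any using (Any)
import Data.List.Relation.Unary.Any.Properties as Any
open import Data.Rational using (-_; mkℚ; nonNegative; +-0-rawMonoid) renaming (_*_ to _·_)
import Data.Integer as ℤ
import Data.Integer.Properties as ℤₚ
open import Data.Nat.Coprimality using (Coprime; 1-coprimeTo) renaming (sym to coprime-sym)
open import Algebra.Definitions.RawMonoid +-0-rawMonoid using () renaming (_×_ to _×ℚ_)
open import Induction.WellFounded using (Acc; acc)
open import Data.Nat.Induction using (<-wellFounded)
open import Data.Rational.Properties
  using (≤-refl; ≤-trans; ≤-reflexive; ≤-decTotalOrder; _≤?_; +-mono-≤; +-monoˡ-≤; +-monoʳ-≤;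
         +-identityˡ; +-identityʳ; +-assoc; +-comm; +-inverseʳ; *-zeroˡ; *-zeroʳ; *-identityˡ;
         *-distribʳ-+; *-monoˡ-≤-nonNeg; p≤p⊔q; p≤q⊔p; normalize-coprime; +-*-commutativeRing;
         module ≤-Reasoning)
  renaming (_≟_ to _≟ℚ_)
open import Relation.Binary.Bundles using (DecTotalOrder)
open import Data.List.Extrema (DecTotalOrder.totalOrder ≤-decTotalOrder) using (argmin; f[argmin]≤v⁺)
open import Data.Product using (Σ; _×_; _,_; proj₁; proj₂)
open import Data.Sum using (_⊎_; inj₁; inj₂)
import Data.Unit
import Data.Maybe as Maybe
open import Data.Empty using (⊥-elim) renaming (⊥ to Empty)
open import Function using (_∘_)
open import Relation.Nullary using (¬_; Dec; yes; no)
open import Relation.Nullary.Decidable using (map′; dec⇒maybe)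
open import Relation.Binary.PropositionalEquality as ≡ using (_≡_; refl; sym; trans; cong; cong₂; subst)
open import Tactic.RingSolver using (solve)
open import Tactic.RingSolver.Core.AlmostCommutativeRing using (AlmostCommutativeRing; fromCommutativeRing)

ℚ-ring : AlmostCommutativeRing _ _
ℚ-ring = fromCommutativeRing +-*-commutativeRing (λ x → Maybe.map sym (dec⇒maybe (x ≟ℚ 0ℚ)))

+-cancelʳ-≤ : ∀ c {a b} → a + c ≤ b + c → a ≤ b
+-cancelʳ-≤ c {a} {b} a+c≤b+c = begin
  a           ≡⟨ solve (a List.∷ c List.∷ List.[]) ℚ-ring ⟩
  a + c + - c ≤⟨ +-monoˡ-≤ (- c) a+c≤b+c ⟩
  b + c + - c ≡⟨ solve (b List.∷ c List.∷ List.[]) ℚ-ring ⟩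
  b           ∎
  where open ≤-Reasoning

p≤p+q : ∀ {p q} → 0ℚ ≤ q → p ≤ p + q
p≤p+q {p} q≥0 = ≤-trans (≤-reflexive (sym (+-identityʳ p))) (+-monoʳ-≤ p q≥0)

/1-suc : ∀ k → + suc k / 1 ≡ 1ℚ + + k / 1
-- The middle term unfolds to (+ 1 ℤ.+ + k ℤ.* + 1) / 1 by the definition of _+_ on ℚ.
/1-suc k = begin
  + suc k / 1              ≡⟨ cong (λ j → (+ 1 ℤ.+ j) / 1) (sym (ℤₚ.*-identityʳ (+ k))) ⟩
  1ℚ + mkℚ (+ k) 0 k⊥1     ≡⟨ cong (_+_ 1ℚ) (sym (normalize-coprime k⊥1)) ⟩
  1ℚ + + k / 1             ∎
  where
  open ≡.≡-Reasoning
  k⊥1 : Coprime k 1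
  k⊥1 = coprime-sym (1-coprimeTo k)

×ℚ≡/1· : ∀ k c → k ×ℚ c ≡ (+ k / 1) · c
×ℚ≡/1· zero    c = sym (*-zeroˡ c)
×ℚ≡/1· (suc k) c = begin
  c + k ×ℚ c             ≡⟨ cong₂ _+_ (sym (*-identityˡ c)) (×ℚ≡/1· k c) ⟩
  1ℚ · c + (+ k / 1) · c ≡⟨ sym (*-distribʳ-+ c 1ℚ (+ k / 1)) ⟩
  (1ℚ + + k / 1) · c     ≡⟨ cong (_· c) (sym (/1-suc k)) ⟩
  (+ suc k / 1) · c      ∎
  where open ≡.≡-Reasoning

×ℚ-mono : ∀ {c} → 0ℚ ≤ c → ∀ {k N} → k ℕ.≤ N → k ×ℚ c ≤ N ×ℚ c
×ℚ-mono {c} c≥0 {N = N} z≤n = nonneg N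
  where
  nonneg : ∀ N → 0ℚ ≤ N ×ℚ c
  nonneg zero    = ≤-refl
  nonneg (suc N) = ≤-trans c≥0 (p≤p+q (nonneg N))
×ℚ-mono {c} c≥0 (s≤s k≤N) = +-monoʳ-≤ c (×ℚ-mono c≥0 k≤N)

∣p∪q∣≤∣p∣+∣q∣ : ∀ {n} (p q : Subset n) → ∣ p ∪ q ∣ ℕ.≤ ∣ p ∣ ℕ.+ ∣ q ∣
∣p∪q∣≤∣p∣+∣q∣ []             []             = z≤n
∣p∪q∣≤∣p∣+∣q∣ (inside ∷ p)  (inside ∷ q)  =
  s≤s (ℕₚ.≤-trans (∣p∪q∣≤∣p∣+∣q∣ p q) (ℕₚ.+-monoʳ-≤ ∣ p ∣ (ℕₚ.n≤1+n ∣ q ∣)))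
∣p∪q∣≤∣p∣+∣q∣ (inside ∷ p)  (outside ∷ q) = s≤s (∣p∪q∣≤∣p∣+∣q∣ p q)
∣p∪q∣≤∣p∣+∣q∣ (outside ∷ p) (inside ∷ q)  =
  ℕₚ.≤-trans (s≤s (∣p∪q∣≤∣p∣+∣q∣ p q)) (ℕₚ.≤-reflexive (sym (ℕₚ.+-suc ∣ p ∣ ∣ q ∣)))
∣p∪q∣≤∣p∣+∣q∣ (outside ∷ p) (outside ∷ q) = ∣p∪q∣≤∣p∣+∣q∣ p q

module _ {n : ℕ} where

  incident : ∀ {m} → (Fin m → Subset n) → Subset m → Subset n
  incident e []            = ⊥
  incident e (inside ∷ F)  = e zero ∪ incident (e ∘ suc) F
  incident e (outside ∷ F) = incident (e ∘ suc) F

  ∈-incident : ∀ {m} (e : Fin m → Subset n) {F h x} → h ∈ F → x ∈ e h → x ∈ incident e F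
  ∈-incident e {inside ∷ F}  here      x∈h = x∈p∪q⁺ (inj₁ x∈h)
  ∈-incident e {inside ∷ F}  (there h∈F) x∈h = x∈p∪q⁺ (inj₂ (∈-incident (e ∘ suc) h∈F x∈h))
  ∈-incident e {outside ∷ F} (there h∈F) x∈h = ∈-incident (e ∘ suc) h∈F x∈h

  ∣incident∣≤ : ∀ {m} (e : Fin m → Subset n) {r} → (∀ h → ∣ e h ∣ ℕ.≤ r) →
                (F : Subset m) → ∣ incident e F ∣ ℕ.≤ ∣ F ∣ * r
  ∣incident∣≤ e bound []            = ℕₚ.≤-reflexive (∣⊥∣≡0 n)
  ∣incident∣≤ e bound (inside ∷ F)  = ℕₚ.≤-trans (∣p∪q∣≤∣p∣+∣q∣ (e zero) _)
                                        (ℕₚ.+-mono-≤ (bound zero) (∣incident∣≤ (e ∘ suc) (bound ∘ suc) F))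
  ∣incident∣≤ e bound (outside ∷ F) = ∣incident∣≤ (e ∘ suc) (bound ∘ suc) F

module Paths {n m : ℕ} (e : Fin m → Subset n) (w : Fin m → ℚ) where

  private variable
    A B : Subset m
    u v x y : Fin n

  infixr 5 _++_
  _++_ : Path e A u x → Path e A x v → Path e A u v
  [] ++ q = q
  step h a b c p ++ q = step h a b c (p ++ q)

  len-++ : (p : Path e A u x) (q : Path e A x v) → len w (p ++ q) ≡ len w p + len w q
  len-++ [] q = sym (+-identityˡ _)
  len-++ (step h _ _ _ p) q = trans (cong (_+_ (w h)) (len-++ p q)) (sym (+-assoc (w h) _ _))

  weaken : A ⊆ B → Path e A u v → Path e B u v
  weaken A⊆B [] = []
  weaken A⊆B (step h a b c p) = step h (A⊆B a) b c (weaken A⊆B p)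

  len-weaken : (A⊆B : A ⊆ B) (p : Path e A u v) → len w (weaken A⊆B p) ≡ len w p
  len-weaken A⊆B [] = refl
  len-weaken A⊆B (step h _ _ _ p) = cong (_+_ (w h)) (len-weaken A⊆B p)

  len-++-weaken : {A⊆B : A ⊆ B} (p : Path e B u x) (q : Path e A x v) →
                  len w (p ++ weaken A⊆B q) ≡ len w p + len w q
  len-++-weaken {A⊆B = A⊆B} p q = trans (len-++ p _) (cong (_+_ (len w p)) (len-weaken A⊆B q))

  reverse : Path e A u v → Path e A v u
  reverse [] = []
  reverse (step h a b c p) = reverse p ++ step h a c b []

  len-reverse : (p : Path e A u v) → len w (reverse p) ≡ len w p
  len-reverse [] = refl
  len-reverse (step h a b c p) = begin
    len w (reverse p ++ step h a c b []) ≡⟨ len-++ (reverse p) _ ⟩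
    len w (reverse p) + (w h + 0ℚ)       ≡⟨ cong (_+ (w h + 0ℚ)) (len-reverse p) ⟩
    len w p + (w h + 0ℚ)                 ≡⟨ cong (_+_ (len w p)) (+-identityʳ (w h)) ⟩
    len w p + w h                        ≡⟨ +-comm (len w p) (w h) ⟩
    w h + len w p                        ∎
    where open ≡.≡-Reasoning

  maxW-nonneg : (p : Path e A u v) → 0ℚ ≤ maxW w p
  maxW-nonneg [] = ≤-refl
  maxW-nonneg (step h _ _ _ p) = ≤-trans (maxW-nonneg p) (p≤q⊔p (w h) _)

  data Suffix : Path e A y v → Path e A x v → Set where
    here  : {R : Path e A x v} → Suffix R R
    there : ∀ {h a b c} {R' : Path e A y v} {R : Path e A x v} →
            Suffix R' R → Suffix R' (step {u = u} h a b c R)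

  ProperSuffix : Path e A y v → Path e A x v → Set
  ProperSuffix R' []                 = Empty
  ProperSuffix R' (step _ _ _ _ R) = Suffix R' R

  Suffix-trans : {R'' : Path e A x v} {R' : Path e A y v} {R : Path e A u v} →
                 Suffix R'' R' → Suffix R' R → Suffix R'' R
  Suffix-trans σ here      = σ
  Suffix-trans σ (there τ) = there (Suffix-trans σ τ)

  prefix : {R' : Path e A y v} {R : Path e A x v} → Suffix R' R → Path e A x y
  prefix here                      = []
  prefix (there {h = h} {a} {b} {c} σ) = step h a b c (prefix σ)

  len-prefix : {R' : Path e A y v} {R : Path e A x v} (σ : Suffix R' R) →
               len w (prefix σ) + len w R' ≡ len w R
  len-prefix here                         = +-identityˡ _
  len-prefix {R' = R'} (there {h = h} σ) =
    trans (+-assoc (w h) _ (len w R')) (cong (_+_ (w h)) (len-prefix σ))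

  maxW-suffix : {R' : Path e A y v} {R : Path e A x v} → Suffix R' R → maxW w R' ≤ maxW w R
  maxW-suffix here                           = ≤-refl
  maxW-suffix (there {h = h} {R = R} σ) = ≤-trans (maxW-suffix σ) (p≤q⊔p (w h) (maxW w R))

  module _ {A : Subset m} {v : Fin n} (Q : ∀ {y} → Path e A y v → Set)
           (Q? : ∀ {y} (R : Path e A y v) → Dec (Q R)) where

    record LastSuffix (R : Path e A x v) : Set where
      field
        {start}  : Fin n
        suffix   : Path e A start v
        isSuffix : Suffix suffix R
        holds    : Q suffix
        last     : ∀ {y} {R' : Path e A y v} → ProperSuffix R' suffix → ¬ Q R'

    private
      search : (R : Path e A x v) → LastSuffix R ⊎ (∀ {y} {R' : Path e A y v} → Suffix R' R → ¬ Q R')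
      search [] with Q? []
      ... | yes q = inj₁ (record { suffix = [] ; isSuffix = here ; holds = q ; last = λ () })
      ... | no ¬q = inj₂ λ { here → ¬q }
      search (step h a b c R) with search R
      ... | inj₁ found =
        inj₁ (record { suffix = suffix ; isSuffix = there isSuffix ; holds = holds ; last = last })
        where open LastSuffix found
      ... | inj₂ none with Q? (step h a b c R)
      ...   | yes q = inj₁ (record { suffix = step h a b c R ; isSuffix = here ; holds = q ; last = none })
      ...   | no ¬q = inj₂ λ { here → ¬q ; (there σ) → none σ }

    lastSuffix : (R : Path e A x v) → Q R → LastSuffix R
    lastSuffix R q with search R
    ... | inj₁ found = found
    ... | inj₂ none  = ⊥-elim (none here q)

  NearShortest : ℚ → Path e A u v → Set
  NearShortest {u = u} {v = v} δ p = (q : Path e ⊤ u v) → len w p ≤ len w q + δ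

  nearShortest-prefix : ∀ {C δ} (p : Path e A u x) (q : Path e B x v) {Q : Path e C u v} →
                        len w p + len w q ≡ len w Q → NearShortest δ Q → NearShortest δ p
  nearShortest-prefix {δ = δ} p q {Q} split near r = +-cancelʳ-≤ (len w q) (begin
    len w p + len w q                         ≡⟨ split ⟩
    len w Q                                   ≤⟨ near (r ++ weaken ⊆⊤ q) ⟩
    len w (r ++ weaken ⊆⊤ q) + δ              ≡⟨ cong (_+ δ) (len-++-weaken r q) ⟩
    len w r + len w q + δ                     ≡⟨ +-assoc (len w r) _ δ ⟩
    len w r + (len w q + δ)                   ≡⟨ cong (_+_ (len w r)) (+-comm (len w q) δ) ⟩
    len w r + (δ + len w q)                   ≡⟨ sym (+-assoc (len w r) δ _) ⟩
    len w r + δ + len w q                     ∎)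
    where open ≤-Reasoning

  record Contact (F : Subset m) (Q : Path e A u v) : Set where
    field
      {vertex}  : Fin n
      touches   : vertex ∈ incident e F
      before    : Path e (A ∩ ∁ F) u vertex
      after     : Path e A vertex v
      len-split : len w before + len w after ≡ len w Q

  avoid-or-contact : ∀ F (Q : Path e A u v) →
                     (Σ (Path e (A ∩ ∁ F) u v) λ Q' → len w Q' ≡ len w Q) ⊎ Contact F Q
  avoid-or-contact F [] = inj₁ ([] , refl)
  avoid-or-contact F (step h a b c Q) with h ∈? F | avoid-or-contact F Q
  ... | yes h∈F | _ = inj₂ (record { touches = ∈-incident e h∈F b ; before = [] ; after = step h a b c Q
                                   ; len-split = +-identityˡ _ })
  ... | no h∉F | inj₁ (Q' , same) =
    inj₁ (step h (x∈p∩q⁺ (a , x∉p⇒x∈∁p h∉F)) b c Q' , cong (_+_ (w h)) same)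
  ... | no h∉F | inj₂ κ = inj₂ (record
    { touches   = touches
    ; before    = step h (x∈p∩q⁺ (a , x∉p⇒x∈∁p h∉F)) b c before
    ; after     = after
    ; len-split = trans (+-assoc (w h) _ _) (cong (_+_ (w h)) len-split)
    })
    where open Contact κ

  module _ (w≥0 : ∀ h → 0ℚ ≤ w h) where

    p≤wh+p : ∀ h {p} → p ≤ w h + p
    p≤wh+p h {p} = ≤-trans (≤-reflexive (sym (+-identityˡ p))) (+-monoˡ-≤ p (w≥0 h))

    hops : Path e A u v → ℕ
    hops []                 = 0
    hops (step _ _ _ _ p) = suc (hops p)

    vertices : Path e A u v → Subset n
    vertices {v = v} []                 = ⁅ v ⁆
    vertices {u = u} (step _ _ _ _ p) = ⁅ u ⁆ ∪ vertices p

    Simple : Path e A u v → Set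
    Simple []                         = Data.Unit.⊤
    Simple {u = u} (step _ _ _ _ p) = u ∉ vertices p × Simple p

    hops<∣vertices∣ : (p : Path e A u v) → Simple p → hops p ℕ.< ∣ vertices p ∣
    hops<∣vertices∣ {v = v} [] _ = ℕₚ.≤-reflexive (sym (∣⁅x⁆∣≡1 v))
    hops<∣vertices∣ {u = u} (step _ _ _ _ p) (u∉p , simple) =
      ℕₚ.<-≤-trans (s≤s (hops<∣vertices∣ p simple))
        (p⊂q⇒∣p∣<∣q∣ (q⊆p∪q ⁅ u ⁆ (vertices p) , u , x∈p∪q⁺ (inj₁ (x∈⁅x⁆ u)) , u∉p))

    SimpleWithin : Subset m → Fin n → Fin n → ℚ → Set
    SimpleWithin A u v L = Σ (Path e A u v) λ q → Simple q × len w q ≤ L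

    suffixFrom : (q : Path e A x v) → u ∈ vertices q → Simple q → SimpleWithin A u v (len w q)
    suffixFrom {v = v} [] u∈q simple with x∈⁅y⁆⇒x≡y v u∈q
    ... | refl = [] , simple , ≤-refl
    suffixFrom {x = x} (step h a b c q) u∈q (x∉q , simple) with x∈p∪q⁻ ⁅ x ⁆ (vertices q) u∈q
    ... | inj₁ u∈x with x∈⁅y⁆⇒x≡y x u∈x
    ...   | refl = step h a b c q , (x∉q , simple) , ≤-refl
    suffixFrom (step h a b c q) u∈q (x∉q , simple) | inj₂ u∈q' =
      let q' , simple' , q'≤q = suffixFrom q u∈q' simple in
      q' , simple' , ≤-trans q'≤q (p≤wh+p h)

    eraseLoops : (p : Path e A u v) → SimpleWithin A u v (len w p)
    eraseLoops [] = [] , _ , ≤-refl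
    eraseLoops {u = u} (step h a b c p) with eraseLoops p
    ... | q , simple , q≤p with u ∈? vertices q
    ...   | no u∉q  = step h a b c q , (u∉q , simple) , +-monoʳ-≤ (w h) q≤p
    ...   | yes u∈q =
      let q' , simple' , q'≤q = suffixFrom q u∈q simple in
      q' , simple' , ≤-trans q'≤q (≤-trans q≤p (p≤wh+p h))

    module _ {A : Subset m} where

      trivialPaths : ∀ u v → List (Path e A u v)
      trivialPaths u v with u ≟ v
      ... | yes refl = List.[ [] ]
      ... | no _     = List.[]

      mutual
        pathsWithin : ℕ → ∀ u v → List (Path e A u v)
        pathsWithin zero    u v = trivialPaths u v
        pathsWithin (suc k) u v =
          trivialPaths u v List.++ concatMap (λ h → concatMap (extensions k u v h) (allFin n)) (allFin m)

        extensions : ℕ → ∀ u v → Fin m → Fin n → List (Path e A u v)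
        extensions k u v h x with h ∈? A | u ∈? e h | x ∈? e h
        ... | yes a | yes b | yes c = List.map (step h a b c) (pathsWithin k x v)
        ... | _     | _     | _     = List.[]

      -- Completeness of the enumeration holds only up to length: the membership proofs stored in a
      -- path are not unique.
      NoLongerIn : List (Path e A u v) → Path e A u v → Set
      NoLongerIn qs p = Any (λ q → len w q ≤ len w p) qs

      trivialPaths-complete : NoLongerIn (trivialPaths u u) []
      trivialPaths-complete {u} with u ≟ u
      ... | yes refl = Any.here ≤-refl
      ... | no u≢u   = ⊥-elim (u≢u refl)

      mutual
        pathsWithin-complete : ∀ k (p : Path e A u v) → hops p ℕ.≤ k → NoLongerIn (pathsWithin k u v) p
        pathsWithin-complete zero    []  _ = trivialPaths-complete
        pathsWithin-complete (suc k) []  _ = Any.++⁺ˡ trivialPaths-complete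
        pathsWithin-complete {u} {v} (suc k) (step {x = x} h a b c p) (s≤s hops≤k) =
          Any.++⁺ʳ (trivialPaths u v) (Any.concatMap⁺ _ (lose (∈-allFin h)
            (Any.concatMap⁺ _ (lose (∈-allFin x) (extensions-complete k h a b c p hops≤k)))))

        extensions-complete : ∀ k h (a : h ∈ A) (b : u ∈ e h) (c : x ∈ e h) (p : Path e A x v) →
                              hops p ℕ.≤ k → NoLongerIn (extensions k u v h x) (step h a b c p)
        extensions-complete {u} {x} k h a b c p hops≤k with h ∈? A | u ∈? e h | x ∈? e h
        ... | yes _ | yes _ | yes _ = Any.map⁺ (Any.map (+-monoʳ-≤ (w h)) (pathsWithin-complete k p hops≤k))
        ... | no h∉A | _     | _     = ⊥-elim (h∉A a)
        ... | yes _  | no u∉h | _     = ⊥-elim (u∉h b)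
        ... | yes _  | yes _  | no x∉h = ⊥-elim (x∉h c)

      pathsWithin-cover : (p : Path e A u v) → NoLongerIn (pathsWithin n u v) p
      pathsWithin-cover p =
        let q , simple , q≤p = eraseLoops p in
        Any.map (λ r≤q → ≤-trans r≤q q≤p)
          (pathsWithin-complete n q (ℕₚ.<⇒≤ (ℕₚ.<-≤-trans (hops<∣vertices∣ q simple) (∣p∣≤n (vertices q)))))

      shortest-or-none : ∀ u v → (Σ (Path e A u v) (IsShortest e w)) ⊎ ¬ Path e A u v
      shortest-or-none u v = minimum (pathsWithin n u v) pathsWithin-cover
        where
        minimum : (qs : List (Path e A u v)) → (∀ p → NoLongerIn qs p) →
                  (Σ (Path e A u v) (IsShortest e w)) ⊎ ¬ Path e A u v
        minimum List.[]       cover = inj₂ (λ p → Any.¬Any[] (cover p))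
        minimum (q List.∷ qs) cover =
          inj₁ (argmin (len w) q qs , λ p → f[argmin]≤v⁺ {f = len w} q qs (Any.toSum (cover p)))

      boundedPath? : ∀ u v (c L : ℚ) → Dec (Σ (Path e A u v) λ q → len w q + c ≤ L)
      boundedPath? u v c L with shortest-or-none u v
      ... | inj₂ none          = no (none ∘ proj₁)
      ... | inj₁ (q , q-least) =
        map′ (q ,_) (λ (p , p-bound) → ≤-trans (+-monoˡ-≤ c (q-least p)) p-bound) (len w q + c ≤? L)

    nearShortest-spanner : ∀ {S α} → IsAdditiveSpanner e w S α →
                           Path e ⊤ u v → Σ (Path e S u v) (NearShortest α)
    nearShortest-spanner {u = u} {v} {α = α} spanner p with shortest-or-none u v
    ... | inj₂ none          = ⊥-elim (none p)
    ... | inj₁ (q , q-least) =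
      let Q , Q≤q+α = spanner u v q in Q , λ r → ≤-trans Q≤q+α (+-monoˡ-≤ α (q-least r))

module _ {α : ℚ} (α≥0 : 0ℚ ≤ α) where
  open ≤-Reasoning

  reroute-bound : ∀ q seg r rest → q ≤ seg + α → seg + r ≡ rest → q + r ≤ rest + (α + α)
  reroute-bound q seg r rest q≤ split = begin
    q + r          ≤⟨ +-monoˡ-≤ r q≤ ⟩
    seg + α + r    ≡⟨ solve (seg List.∷ α List.∷ r List.∷ List.[]) ℚ-ring ⟩
    seg + r + α    ≡⟨ cong (_+ α) split ⟩
    rest + α       ≤⟨ +-monoʳ-≤ rest (p≤p+q α≥0) ⟩
    rest + (α + α) ∎

  loop-bound : ∀ p₁ p' s₁ pre r' seg r rest → p' ≤ s₁ + pre + α → p₁ + s₁ ≤ seg + α →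
               pre + r' ≡ r → seg + r ≡ rest → p₁ + p' + r' ≤ rest + (α + α)
  loop-bound p₁ p' s₁ pre r' seg r rest p'≤ p₁s₁≤ split' split = begin
    p₁ + p' + r'                  ≤⟨ +-monoˡ-≤ r' (+-monoʳ-≤ p₁ p'≤) ⟩
    p₁ + (s₁ + pre + α) + r'      ≡⟨ solve (p₁ List.∷ s₁ List.∷ pre List.∷ α List.∷ r' List.∷ List.[]) ℚ-ring ⟩
    (p₁ + s₁) + (pre + r') + α    ≤⟨ +-monoˡ-≤ α (+-mono-≤ p₁s₁≤ (≤-reflexive split')) ⟩
    (seg + α) + r + α             ≡⟨ solve (seg List.∷ α List.∷ r List.∷ List.[]) ℚ-ring ⟩
    (seg + r) + (α + α)           ≡⟨ cong (_+ (α + α)) split ⟩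
    rest + (α + α)                ∎

  finish-bound : ∀ b r p k q K → b + r ≤ p + k → q ≤ r + α → k ≤ K → b + q ≤ p + K + α
  finish-bound b r p k q K b+r≤ q≤ k≤K = begin
    b + q         ≤⟨ +-monoʳ-≤ b q≤ ⟩
    b + (r + α)   ≡⟨ sym (+-assoc b r α) ⟩
    b + r + α     ≤⟨ +-monoˡ-≤ α (≤-trans b+r≤ (+-monoʳ-≤ p k≤K)) ⟩
    p + K + α     ∎

  finish-bound-2α : ∀ b r p k g c K → b + r ≤ p + k → g + 0ℚ ≤ r + (α + α) → α ≤ c → c + k ≤ K →
                    b + g ≤ p + K + α
  finish-bound-2α b r p k g c K b+r≤ g≤ α≤c c+k≤K = begin
    b + g             ≡⟨ cong (_+_ b) (sym (+-identityʳ g)) ⟩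
    b + (g + 0ℚ)      ≤⟨ +-monoʳ-≤ b g≤ ⟩
    b + (r + (α + α)) ≡⟨ solve (b List.∷ r List.∷ α List.∷ List.[]) ℚ-ring ⟩
    b + r + α + α     ≤⟨ +-monoˡ-≤ α (+-mono-≤ b+r≤ α≤c) ⟩
    p + k + c + α     ≡⟨ solve (p List.∷ k List.∷ c List.∷ α List.∷ List.[]) ℚ-ring ⟩
    p + (c + k) + α   ≤⟨ +-monoˡ-≤ α (+-monoʳ-≤ p c+k≤K) ⟩
    p + K + α         ∎

round-bound : ∀ α μ W b g d r' wh r p k → 0ℚ ≤ μ - 1ℚ → b + r ≤ p + k → g + (wh + r') ≤ r + (α + α) →
              d ≤ μ · (wh + 0ℚ) → wh ≤ W → b + (g + d) + r' ≤ p + ((α + α + (μ - 1ℚ) · W) + k)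
round-bound α μ W b g d r' wh r p k μ-1≥0 b+r≤ g≤ d≤ wh≤W = begin
  b + (g + d) + r'
    ≤⟨ +-monoˡ-≤ r' (+-monoʳ-≤ b (+-monoʳ-≤ g d≤)) ⟩
  b + (g + μ · (wh + 0ℚ)) + r'
    ≡⟨ solve (b List.∷ g List.∷ μ List.∷ wh List.∷ r' List.∷ List.[]) ℚ-ring ⟩
  b + (g + (wh + r')) + (μ - 1ℚ) · wh
    ≤⟨ +-mono-≤ (+-monoʳ-≤ b g≤) (*-monoˡ-≤-nonNeg (μ - 1ℚ) {{nonNegative μ-1≥0}} wh≤W) ⟩
  b + (r + (α + α)) + (μ - 1ℚ) · W
    ≡⟨ solve (b List.∷ r List.∷ α List.∷ μ List.∷ W List.∷ List.[]) ℚ-ring ⟩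
  (b + r) + (α + α + (μ - 1ℚ) · W)
    ≤⟨ +-monoˡ-≤ _ b+r≤ ⟩
  p + k + (α + α + (μ - 1ℚ) · W)
    ≡⟨ solve (p List.∷ k List.∷ α List.∷ μ List.∷ W List.∷ List.[]) ℚ-ring ⟩
  p + ((α + α + (μ - 1ℚ) · W) + k)
    ∎
  where open ≤-Reasoning

module Detour {n m : ℕ} (e : Fin m → Subset n) (w : Fin m → ℚ) (w≥0 : ∀ h → 0ℚ ≤ w h)
  {F S₁ S₂ : Subset m} {f : ℕ} {α μ : ℚ} (α≥0 : 0ℚ ≤ α) (μ≥1 : 1ℚ ≤ μ) (∣F∣≤f : ∣ F ∣ ℕ.≤ f)
  (S₁-spanner : IsFTMultSpanner e w S₁ f μ) (S₂-spanner : IsAdditiveSpanner e w S₂ α)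
  {s t : Fin n} (P : Path e (∁ F) s t) where

  open Paths e w

  private variable
    u x y : Fin n

  roundCost : ℚ
  roundCost = (α + α) + (μ - 1ℚ) · maxW w P

  FV : Subset n
  FV = incident e F

  Rest : Fin n → Set
  Rest x = Path e (∁ F) x t

  Bypass : Fin n → Fin n → Set
  Bypass = Path e (S₂ ∩ ∁ F)

  Union : Subset m
  Union = (S₁ ∪ S₂) ∩ ∁ F

  S₁∖F⊆Union : S₁ ∩ ∁ F ⊆ Union
  S₁∖F⊆Union h∈ = let h∈S₁ , h∉F = x∈p∩q⁻ S₁ (∁ F) h∈ in x∈p∩q⁺ (p⊆p∪q S₂ h∈S₁ , h∉F)

  S₂∖F⊆Union : S₂ ∩ ∁ F ⊆ Union
  S₂∖F⊆Union h∈ = let h∈S₂ , h∉F = x∈p∩q⁻ S₂ (∁ F) h∈ in x∈p∩q⁺ (q⊆p∪q S₁ S₂ h∈S₂ , h∉F)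

  Goal : ℕ → Set
  Goal N = DistAtMost e w Union s t (len w P + N ×ℚ roundCost + α)

  μ-1≥0 : 0ℚ ≤ μ - 1ℚ
  μ-1≥0 = ≤-trans (≤-reflexive (sym (+-inverseʳ 1ℚ))) (+-monoˡ-≤ (- 1ℚ) μ≥1)

  α≤roundCost : α ≤ roundCost
  α≤roundCost = ≤-trans (p≤p+q α≥0) (p≤p+q (≤-trans (≤-reflexive (sym (*-zeroʳ (μ - 1ℚ))))
                  (*-monoˡ-≤-nonNeg (μ - 1ℚ) {{nonNegative μ-1≥0}} (maxW-nonneg P))))

  roundCost≥0 : 0ℚ ≤ roundCost
  roundCost≥0 = ≤-trans α≥0 α≤roundCost

  Jump : Rest u → Rest y → Set
  Jump {u} {y} R R' = Σ (Bypass u y) λ g → len w g + len w R' ≤ len w R + (α + α)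

  Jump? : (R : Rest u) (R' : Rest y) → Dec (Jump R R')
  Jump? R R' = boundedPath? w≥0 _ _ (len w R') (len w R + (α + α))

  Jump-refl : (R : Rest u) → Jump R R
  Jump-refl R = [] , ≤-trans (≤-reflexive (+-identityˡ (len w R))) (p≤p+q (+-mono-≤ α≥0 α≥0))

  Blocked : Fin n → Rest x → Set
  Blocked z R = ∀ {y} {R' : Rest y} → Suffix R' R → (p : Bypass y z) → ¬ NearShortest α p

  record State (N : ℕ) : Set where
    field
      {current}   : Fin n
      rest        : Rest current
      rest-suffix : Suffix rest P
      built       : Path e Union s current
      rounds      : ℕ
      fresh       : Subset n
      budget      : rounds ℕ.+ ∣ fresh ∣ ℕ.≤ N
      len-bound   : len w built + len w rest ≤ len w P + rounds ×ℚ roundCost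
      blocked     : ∀ z → z ∈ FV → z ∉ fresh → Blocked z rest

  record FreshContact (fresh : Subset n) (u x : Fin n) (bound : ℚ) : Set where
    field
      {vertex}   : Fin n
      isFresh    : vertex ∈ fresh
      toVertex   : Bypass u vertex
      fromVertex : Path e ⊤ vertex x
      len-split≤ : len w toVertex + len w fromVertex ≤ bound

  module Round {N : ℕ} (st : State N) where
    open State st

    probe : (Seg : Path e ⊤ current x) →
            (Σ (Bypass current x) λ Q → len w Q ≤ len w Seg + α) ⊎ FreshContact fresh current x (len w Seg + α)
    probe Seg with nearShortest-spanner w≥0 S₂-spanner Seg
    ... | Q , near with avoid-or-contact F Q
    ...   | inj₁ (Q' , same) = inj₁ (Q' , ≤-trans (≤-reflexive same) (near Seg))
    ...   | inj₂ κ with Contact.vertex κ ∈? fresh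
    ...     | yes isFresh = inj₂ (record
      { isFresh    = isFresh
      ; toVertex   = before
      ; fromVertex = weaken ⊆⊤ after
      ; len-split≤ = ≤-trans (≤-reflexive (trans (cong (_+_ (len w before)) (len-weaken ⊆⊤ after)) len-split))
                       (near Seg)
      })
      where open Contact κ
    ...     | no used =
      ⊥-elim (blocked vertex touches used here before (nearShortest-prefix before after {Q} len-split near))
      where open Contact κ

    finish : Jump rest ([] {u = t}) → Goal N
    finish (g , g≤) with probe (weaken ⊆⊤ rest)
    ... | inj₁ (Q , Q≤) = built ++ weaken S₂∖F⊆Union Q , (begin
      len w (built ++ weaken S₂∖F⊆Union Q) ≡⟨ len-++-weaken built Q ⟩
      len w built + len w Q
        ≤⟨ finish-bound α≥0 (len w built) (len w rest) (len w P) _ (len w Q) _ len-bound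
             (≤-trans Q≤ (≤-reflexive (cong (_+ α) (len-weaken ⊆⊤ rest))))
             (×ℚ-mono roundCost≥0 (ℕₚ.≤-trans (ℕₚ.m≤m+n rounds _) budget)) ⟩
      len w P + N ×ℚ roundCost + α          ∎)
      where open ≤-Reasoning
    -- A fresh vertex incident to F is left, so one more round fits the budget and pays for g.
    ... | inj₂ κ = built ++ weaken S₂∖F⊆Union g , (begin
      len w (built ++ weaken S₂∖F⊆Union g) ≡⟨ len-++-weaken built g ⟩
      len w built + len w g
        ≤⟨ finish-bound-2α α≥0 (len w built) (len w rest) (len w P) _ (len w g) roundCost _
             len-bound g≤ α≤roundCost (×ℚ-mono roundCost≥0 (ℕₚ.≤-trans one-more-round budget)) ⟩
      len w P + N ×ℚ roundCost + α          ∎)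
      where
      open ≤-Reasoning
      one-more-round : suc rounds ℕ.≤ rounds ℕ.+ ∣ fresh ∣
      one-more-round = ℕₚ.m<m+n rounds (ℕₚ.≤-<-trans z≤n (x∈p⇒∣p-x∣<∣p∣ (FreshContact.isFresh κ)))

    module Advance {v v' h a b c} {R' : Rest v'} (σ : Suffix (step {u = v} h a b c R') rest)
                   (jump : Jump rest (step h a b c R'))
                   (later-fails : ∀ {y} {R'' : Rest y} → Suffix R'' R' → ¬ Jump rest R'') where

      σ' : Suffix R' rest
      σ' = Suffix-trans (there here) σ

      segment : Path e ⊤ current v'
      segment = weaken ⊆⊤ (prefix σ')

      segment-split : len w segment + len w R' ≡ len w rest
      segment-split = trans (cong (_+ len w R') (len-weaken ⊆⊤ (prefix σ'))) (len-prefix σ')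

      module _ (κ : FreshContact fresh current v' (len w segment + α)) where
        open FreshContact κ

        newly-blocked : Blocked vertex R'
        newly-blocked {R' = R''} τ p' near = later-fails τ (toVertex ++ reverse p' , (begin
          len w (toVertex ++ reverse p') + len w R''
            ≡⟨ cong (_+ len w R'') (trans (len-++ toVertex _) (cong (_+_ (len w toVertex)) (len-reverse p'))) ⟩
          len w toVertex + len w p' + len w R''
            ≤⟨ loop-bound α≥0 (len w toVertex) (len w p') (len w fromVertex) (len w (prefix τ)) (len w R'')
                 (len w segment) (len w R') (len w rest) p'≤ len-split≤ (len-prefix τ) segment-split ⟩
          len w rest + (α + α) ∎))
          where
          open ≤-Reasoning
          back : Path e ⊤ _ vertex
          back = reverse (fromVertex ++ weaken ⊆⊤ (prefix τ))
          p'≤ : len w p' ≤ len w fromVertex + len w (prefix τ) + α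
          p'≤ = ≤-trans (near back) (≤-reflexive (cong (_+ α)
                  (trans (len-reverse (fromVertex ++ _)) (len-++-weaken fromVertex (prefix τ)))))

        still-blocked : ∀ z → z ∈ FV → z ∉ fresh ∖ vertex → Blocked z R'
        still-blocked z z∈FV z∉fresh' with z ≟ vertex
        ... | yes refl    = newly-blocked
        ... | no z≢vertex = λ τ →
          blocked z z∈FV (λ z∈fresh → z∉fresh' (x∈p∧x≢y⇒x∈p-y z∈fresh z≢vertex)) (Suffix-trans τ σ')

        next : State N
        next = record
          { rest        = R'
          ; rest-suffix = Suffix-trans σ' rest-suffix
          ; built       = built ++ (weaken S₂∖F⊆Union g ++ weaken S₁∖F⊆Union D)
          ; rounds      = suc rounds
          ; fresh       = fresh ∖ vertex
          ; budget      = ℕₚ.≤-trans (ℕₚ.≤-reflexive (sym (ℕₚ.+-suc rounds _)))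
                            (ℕₚ.≤-trans (ℕₚ.+-monoʳ-≤ rounds (x∈p⇒∣p-x∣<∣p∣ isFresh)) budget)
          ; len-bound   = begin
              len w (built ++ (weaken S₂∖F⊆Union g ++ weaken S₁∖F⊆Union D)) + len w R'
                ≡⟨ cong (_+ len w R') (trans (len-++ built _) (cong (_+_ (len w built)) (len-++-weaken (weaken S₂∖F⊆Union g) D))) ⟩
              len w built + (len w (weaken S₂∖F⊆Union g) + len w D) + len w R'
                ≡⟨ cong (λ l → len w built + (l + len w D) + len w R') (len-weaken S₂∖F⊆Union g) ⟩
              len w built + (len w g + len w D) + len w R'
                ≤⟨ round-bound α μ (maxW w P) (len w built) (len w g) (len w D) (len w R') (w h) (len w rest)
                     (len w P) (rounds ×ℚ roundCost) μ-1≥0 len-bound (proj₂ jump) D≤ wh≤W ⟩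
              len w P + suc rounds ×ℚ roundCost ∎
          ; blocked     = still-blocked
          }
          where
          open ≤-Reasoning
          g : Bypass current v
          g = proj₁ jump
          D : Path e (S₁ ∩ ∁ F) v v'
          D = proj₁ (S₁-spanner F ∣F∣≤f v v' (step h a b c []))
          D≤ : len w D ≤ μ · (w h + 0ℚ)
          D≤ = proj₂ (S₁-spanner F ∣F∣≤f v v' (step h a b c []))
          wh≤W : w h ≤ maxW w P
          wh≤W = ≤-trans (p≤p⊔q (w h) (maxW w R')) (maxW-suffix (Suffix-trans σ rest-suffix))

      advance : Σ (State N) λ st' → ∣ State.fresh st' ∣ ℕ.< ∣ fresh ∣
      advance with probe segment
      -- A fault-free Q would be a jump beyond v.
      ... | inj₁ (Q , Q≤) =
        ⊥-elim (later-fails here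
          (Q , reroute-bound α≥0 (len w Q) (len w segment) (len w R') (len w rest) Q≤ segment-split))
      ... | inj₂ κ = next κ , x∈p⇒∣p-x∣<∣p∣ (FreshContact.isFresh κ)

    round : Goal N ⊎ Σ (State N) λ st' → ∣ State.fresh st' ∣ ℕ.< ∣ fresh ∣
    round with lastSuffix (Jump rest) (Jump? rest) rest (Jump-refl rest)
    ... | record { suffix = [] ; holds = g } = inj₁ (finish g)
    ... | record { suffix = step h a b c R' ; isSuffix = σ ; holds = g ; last = later-fails } =
      inj₂ (Advance.advance σ g later-fails)

  run : ∀ {N} (st : State N) → Acc ℕ._<_ ∣ State.fresh st ∣ → Goal N
  run st (acc smaller) with Round.round st
  ... | inj₁ done            = done
  ... | inj₂ (st' , shrinks) = run st' (smaller shrinks)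

  detour : ∀ {N} → ∣ FV ∣ ℕ.≤ N → Goal N
  detour ∣FV∣≤N = run start (<-wellFounded _)
    where
    start : State _
    start = record
      { rest = P ; rest-suffix = here ; built = [] ; rounds = 0 ; fresh = FV ; budget = ∣FV∣≤N
      ; len-bound = ≤-reflexive (trans (+-identityˡ (len w P)) (sym (+-identityʳ (len w P))))
      ; blocked = λ z z∈FV z∉FV → ⊥-elim (z∉FV z∈FV)
      }

theorem3 : ∀ {n m : ℕ} (e : Fin m → Subset n) (w : Fin m → ℚ) (r f : ℕ) (μ α : ℚ)
             (S₁ S₂ : Subset m) →
             (∀ h → 0ℚ ≤ w h) → IsRank e r → 1 Data.Nat.≤ f → 1ℚ ≤ μ → 0ℚ ≤ α →
             IsFTMultSpanner e w S₁ f μ → IsAdditiveSpanner e w S₂ α →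
             ∀ (s t : Fin n) (F : Subset m) → ∣ F ∣ Data.Nat.≤ f →
             (P : Path e (∁ F) s t) → IsShortest e w P →
             DistAtMost e w ((S₁ ∪ S₂) ∩ ∁ F) s t
               (len w P + (+ (f * r) / 1) Data.Rational.* ((α + α) + (μ - 1ℚ) Data.Rational.* maxW w P) + α)
theorem3 e w r f μ α S₁ S₂ w≥0 (edges≤r , _) _ μ≥1 α≥0 S₁-spanner S₂-spanner s t F ∣F∣≤f P _ =
  subst (λ K → DistAtMost e w ((S₁ ∪ S₂) ∩ ∁ F) s t (len w P + K + α)) (×ℚ≡/1· (f * r) roundCost)
    (detour (ℕₚ.≤-trans (∣incident∣≤ e edges≤r F) (ℕₚ.*-monoˡ-≤ r ∣F∣≤f)))
  where open Detour e w w≥0 α≥0 μ≥1 ∣F∣≤f S₁-spanner S₂-spanner P
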